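{- Let $n=p_1^{n_1}\cdots p_r^{n_r}$ with primes $p_1<\cdots<p_r$, positive integers $n_i$, and $r\geq 2$. For every $a\in[r]$ and $s\in[n_a]$, $Z_a^s$ is a cut-set of $\mathcal{P}(C_n)$.
   Context: $C_n$ is the cyclic group of order $n$; $[m]=\{1,\dots,m\}$. The power graph $\mathcal{P}(C_n)$ has vertex set $C_n$, two distinct vertices adjacent if one is a power of the other. A cut-set is a vertex set whose removal leaves a disconnected induced subgraph. $E_d$ is the set of elements of $C_n$ of order $d$, $S_d$ the subgroup of order $d$. $Q_a^s$ is the union of the subgroups $S_{n/(p_ip_a^s)}$ over $i\in[r]\setminus\{a\}$, and $Z_a^s:=E_n\cup E_{n/p_a}\cup\cdots\cup E_{n/p_a^{s-1}}\cup Q_a^s$. -}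

module Defs where

open import Data.Nat using (ℕ; zero; suc; _+_; _*_; _^_; _<_; _≤_)
open import Data.Nat.Divisibility using (_∣_)
open import Data.Fin using (Fin; toℕ) renaming (zero to fzero; suc to fsuc)
open import Data.Product using (Σ; ∃; _×_; _,_)
open import Data.Sum using (_⊎_)
open import Relation.Nullary using (¬_)
open import Relation.Binary.PropositionalEquality using (_≡_; _≢_)

prodFin : (r : ℕ) → (Fin r → ℕ) → ℕ
prodFin zero    f = 1
prodFin (suc r) f = f fzero * prodFin r (λ i → f (fsuc i))

-- The cyclic group C_n is modelled additively as ℤ/nℤ with carrier Fin n
-- (elements 0..n-1, operation addition mod n).

IsPowerOf : (n : ℕ) → Fin n → Fin n → Set
IsPowerOf n y x = ∃ λ k → ∃ λ q → k * toℕ x ≡ toℕ y + q * n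

Adj : (n : ℕ) → Fin n → Fin n → Set
Adj n x y = x ≢ y × (IsPowerOf n y x ⊎ IsPowerOf n x y)

IsOrder : (n : ℕ) → Fin n → ℕ → Set
IsOrder n x d = (0 < d) × (n ∣ d * toℕ x) × (∀ k → 0 < k → k < d → ¬ (n ∣ k * toℕ x))

InE : (n : ℕ) → ℕ → Fin n → Set
InE n d x = IsOrder n x d

-- S_d : the subgroup of order d (for d ∣ n) = { x : d·x = 0 }
InS : (n : ℕ) → ℕ → Fin n → Set
InS n d x = n ∣ d * toℕ x

data Reach (n : ℕ) (X : Fin n → Set) : Fin n → Fin n → Set where
  here : ∀ {u} → ¬ X u → Reach n X u u
  step : ∀ {u v w} → Reach n X u v → Adj n v w → ¬ X w → Reach n X u w

IsCutSet : (n : ℕ) → (Fin n → Set) → Set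
IsCutSet n X = ∃ λ u → ∃ λ v → ¬ X u × ¬ X v × ¬ Reach n X u v

InQ : (n r : ℕ) (p : Fin r → ℕ) (a : Fin r) (s : ℕ) → Fin n → Set
InQ n r p a s x = ∃ λ i → (i ≢ a) × ∃ λ d → (d * (p i * p a ^ s) ≡ n) × InS n d x

InZ : (n r : ℕ) (p : Fin r → ℕ) (a : Fin r) (s : ℕ) → Fin n → Set
InZ n r p a s x =
  (∃ λ j → (j < s) × ∃ λ d → (d * p a ^ j ≡ n) × InE n d x) ⊎ InQ n r p a s x

-- Write n = m · p_a^s, so that u = p_a^s has order m, and let S_m be the subgroup of order m.
-- The component of u in P(C_n) − Z_a^s stays inside S_m, which does not contain v = p_b
-- for any b ≠ a.  Edges x → kx out of S_m are impossible since S_m is a subgroup.  If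
-- x = ky with x ∈ S_m and y ∉ S_m, write the order of y as d = n / g, g = gcd(y, n):
-- a prime p_i ≠ p_a dividing g would put x into S_{n/(p_i p_a^s)} ⊆ Q_a^s, so g = p_a^j,
-- and y ∉ S_m forces j < s, i.e. y ∈ E_{n/p_a^j} ⊆ Z_a^s.
module Submission where

open import Defs
open import Data.Nat using (ℕ; _^_; _<_; _≤_)
open import Data.Nat.Primality using (Prime)
open import Data.Fin using (Fin) renaming (_<_ to _<ᶠ_)
open import Relation.Binary.PropositionalEquality using (_≡_)

open import Data.Nat
open import Data.Nat.Properties
open import Algebra.Properties.CommutativeSemigroup *-commutativeSemigroup
  using (x∙yz≈y∙xz; x∙yz≈yx∙z; xy∙z≈xz∙y; xy∙z≈y∙xz)
open import Data.Nat.Divisibility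
open import Data.Nat.Coprimality using (Coprime; coprime-divisor; coprime-factors)
open import Data.Nat.GCD using (gcd; gcd[m,n]∣m; gcd[m,n]∣n; gcd-greatest; gcd[m,n]≢0)
open import Data.Nat.Primality using (prime⇒irreducible; prime⇒nonZero; prime⇒nonTrivial)
open import Data.Nat.Tactic.RingSolver using (solve-∀)
open import Data.Fin using (toℕ; fromℕ<; punchIn; punchOut) renaming (zero to fzero; suc to fsuc)
import Data.Fin.Properties as Fin
open import Data.Product using (∃; _×_; _,_)
open import Data.Sum using (inj₁; inj₂)
open import Function using (_∘_; _⇔_; mk⇔; Equivalence)
open import Relation.Nullary using (¬_; yes; no; contradiction)
open import Relation.Binary.PropositionalEquality
open import Relation.Binary.Definitions using (tri<; tri≈; tri>)

open Equivalence using (to; from)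

coprime-*ʳ : ∀ {c l n} → Coprime c l → Coprime c n → Coprime c (l * n)
coprime-*ʳ c⊥l c⊥n (d∣c , d∣ln) =
  c⊥n (d∣c , coprime-divisor (λ (e∣d , e∣l) → c⊥l (∣-trans e∣d d∣c , e∣l)) d∣ln)

coprime-^ʳ : ∀ {c l} k → Coprime c l → Coprime c (l ^ k)
coprime-^ʳ zero    _   (_ , d∣1) = ∣1⇒≡1 d∣1
coprime-^ʳ (suc k) c⊥l = coprime-*ʳ c⊥l (coprime-^ʳ k c⊥l)

∤prime⇒coprime : ∀ {q c} → Prime q → ¬ q ∣ c → Coprime c q
∤prime⇒coprime q-prime q∤c (d∣c , d∣q) with prime⇒irreducible q-prime d∣q
... | inj₁ d≡1  = d≡1
... | inj₂ refl = contradiction d∣c q∤c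

prime≢1 : ∀ {q} → Prime q → q ≢ 1
prime≢1 q-prime = nonTrivial⇒≢1 {{prime⇒nonTrivial q-prime}}

prime>1 : ∀ {q} → Prime q → 1 < q
prime>1 {q} q-prime = nonTrivial⇒n>1 q {{prime⇒nonTrivial q-prime}}

prime∤prime : ∀ {q r} → Prime q → Prime r → q ≢ r → ¬ q ∣ r
prime∤prime q-prime r-prime q≢r q∣r with prime⇒irreducible r-prime q∣r
... | inj₁ q≡1 = prime≢1 q-prime q≡1
... | inj₂ q≡r = q≢r q≡r

prime^∤prime : ∀ {q r} k → Prime q → Prime r → q ≢ r → 1 ≤ k → ¬ q ^ k ∣ r
prime^∤prime {q} (suc k) q-prime r-prime q≢r _ q^k∣r =
  prime∤prime q-prime r-prime q≢r (∣-trans (m∣m*n (q ^ k)) q^k∣r)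

prime^≢prime : ∀ {q r} j → Prime q → Prime r → q ≢ r → q ^ j ≢ r
prime^≢prime zero    _       r-prime _   1≡r   = prime≢1 r-prime (sym 1≡r)
prime^≢prime (suc j) q-prime r-prime q≢r q^j≡r =
  prime^∤prime (suc j) q-prime r-prime q≢r (s≤s z≤n) (∣-reflexive q^j≡r)

m∣m^n : ∀ {q} k → 1 ≤ k → q ∣ q ^ k
m∣m^n (suc k) _ = m∣m*n _

∣prime^⇒≡prime^ : ∀ {q d} e → Prime q → d ∣ q ^ e → ∃ λ j → d ≡ q ^ j
∣prime^⇒≡prime^ zero    _ d∣1 = 0 , ∣1⇒≡1 d∣1
∣prime^⇒≡prime^ {q} {d} (suc e) q-prime d∣q^e with q ∣? d
... | no  q∤d = ∣prime^⇒≡prime^ e q-prime (coprime-divisor (∤prime⇒coprime q-prime q∤d) d∣q^e)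
... | yes (divides d′ refl) with ∣prime^⇒≡prime^ e q-prime d′∣q^e
  where
  instance _ = prime⇒nonZero q-prime
  d′∣q^e : d′ ∣ q ^ e
  d′∣q^e = *-cancelʳ-∣ q (subst (d′ * q ∣_) (*-comm q (q ^ e)) d∣q^e)
...   | j , refl = suc j , *-comm (q ^ j) q

∣*⇔∣*-mod : ∀ {a b q n c} → a ≡ b + q * n → n ∣ c * a ⇔ n ∣ c * b
∣*⇔∣*-mod {a} {b} {q} {n} {c} a≡b+qn = mk⇔
  (λ n∣ca → ∣m+n∣m⇒∣n (subst (n ∣_) ca≡ n∣ca) (n∣m*n (c * q)))
  (λ n∣cb → subst (n ∣_) (sym ca≡) (∣m∣n⇒∣m+n (n∣m*n (c * q)) n∣cb))
  where
  distrib : ∀ c b q n → c * (b + q * n) ≡ c * q * n + c * b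
  distrib = solve-∀
  ca≡ : c * a ≡ c * q * n + c * b
  ca≡ = trans (cong (c *_) a≡b+qn) (distrib c b q n)

m∣n⇒gcd[m,n]≡m : ∀ {l n} → l ∣ n → gcd l n ≡ l
m∣n⇒gcd[m,n]≡m {l} {n} l∣n = ∣-antisym (gcd[m,n]∣m l n) (gcd-greatest ∣-refl l∣n)

-- The cofactor d of gcd w n in n is the order of w in ℤ/nℤ.
∣*⇔cofactor∣ : ∀ {n d w t} .{{_ : NonZero n}} → d * gcd w n ≡ n → n ∣ t * w ⇔ d ∣ t
∣*⇔cofactor∣ {n} {d} {w} {t} d*g≡n = mk⇔
  (λ n∣tw → coprime-divisor d⊥w′
    (subst (d ∣_) (*-comm t w′) (*-cancelʳ-∣ g (subst₂ _∣_ (sym d*g≡n) tw≡ n∣tw))))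
  (λ d∣t → subst₂ _∣_ d*g≡n (sym tw≡) (*-monoˡ-∣ g (∣m⇒∣m*n w′ d∣t)))
  where
  g = gcd w n
  instance
    g≢0 : NonZero g
    g≢0 = ≢-nonZero (gcd[m,n]≢0 w n (inj₂ (≢-nonZero⁻¹ n)))
  g∣w = gcd[m,n]∣m w n
  w′ = quotient g∣w
  w≡w′g : w ≡ w′ * g
  w≡w′g = m∣n⇒n≡quotient*m g∣w
  tw≡ : t * w ≡ t * w′ * g
  tw≡ = trans (cong (t *_) w≡w′g) (sym (*-assoc t w′ g))
  d⊥w′ : Coprime d w′
  d⊥w′ {c} (c∣d , c∣w′) = ∣1⇒≡1 (*-cancelʳ-∣ g (subst (c * g ∣_) (sym (*-identityˡ g))
    (gcd-greatest (subst (c * g ∣_) (sym w≡w′g) (*-monoˡ-∣ g c∣w′))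
                  (subst (c * g ∣_) d*g≡n (*-monoˡ-∣ g c∣d)))))

cofactor-isOrder : ∀ {n d} .{{_ : NonZero n}} (x : Fin n) → d * gcd (toℕ x) n ≡ n → IsOrder n x d
cofactor-isOrder {n} {d} x d*g≡n =
  0<d , order .from (∣-refl {d}) ,
  λ t 0<t t<d n∣tx → <⇒≱ t<d (∣⇒≤ {{>-nonZero 0<t}} (order .to n∣tx))
  where
  order : ∀ {t} → n ∣ t * toℕ x ⇔ d ∣ t
  order = ∣*⇔cofactor∣ d*g≡n
  0<d : 0 < d
  0<d = n≢0⇒n>0 λ d≡0 → ≢-nonZero⁻¹ n (trans (sym d*g≡n) (cong (_* _) d≡0))

divisor-isOrder : ∀ {n d} .{{_ : NonZero n}} (x : Fin n) → d * toℕ x ≡ n → IsOrder n x d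
divisor-isOrder {n} {d} x d*x≡n =
  cofactor-isOrder x (trans (cong (d *_) (m∣n⇒gcd[m,n]≡m (divides d (sym d*x≡n)))) d*x≡n)

isOrder-unique : ∀ {n d e} {x : Fin n} → IsOrder n x d → IsOrder n x e → d ≡ e
isOrder-unique {d = d} {e} (0<d , n∣dx , d-least) (0<e , n∣ex , e-least) with <-cmp d e
... | tri< d<e _   _   = contradiction n∣dx (e-least d 0<d d<e)
... | tri≈ _   d≡e _   = d≡e
... | tri> _   _   e<d = contradiction n∣ex (d-least e 0<e e<d)

closed⇒isCutSet : ∀ {n} {X S : Fin n → Set} (u v : Fin n) → ¬ X u → ¬ X v → S u → ¬ S v →
                  (∀ {x y} → S x → ¬ X x → ¬ X y → Adj n x y → S y) → IsCutSet n X
closed⇒isCutSet {n} {X} {S} u v u∉X v∉X u∈S v∉S closed =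
  u , v , u∉X , v∉X , λ u⇝v → v∉S (reached-∈ u⇝v)
  where
  reached-∉ : ∀ {y} → Reach n X u y → ¬ X y
  reached-∉ (here y∉X)     = y∉X
  reached-∉ (step _ _ y∉X) = y∉X
  reached-∈ : ∀ {y} → Reach n X u y → S y
  reached-∈ (here _)             = u∈S
  reached-∈ (step u⇝x x~y y∉X) = closed (reached-∈ u⇝x) (reached-∉ u⇝x) y∉X x~y

prodFin-nonZero : ∀ r (f : Fin r → ℕ) → (∀ i → NonZero (f i)) → NonZero (prodFin r f)
prodFin-nonZero zero    f f≢0 = _
prodFin-nonZero (suc r) f f≢0 =
  m*n≢0 _ _ {{f≢0 fzero}} {{prodFin-nonZero r (f ∘ fsuc) (f≢0 ∘ fsuc)}}

∣prodFin : ∀ r (f : Fin r → ℕ) i → f i ∣ prodFin r f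
∣prodFin (suc r) f fzero    = m∣m*n _
∣prodFin (suc r) f (fsuc i) = ∣n⇒∣m*n (f fzero) (∣prodFin r (f ∘ fsuc) i)

coprime-prodFin : ∀ {c} r (f : Fin r → ℕ) → (∀ i → Coprime c (f i)) → Coprime c (prodFin r f)
coprime-prodFin zero    f _   (_ , d∣1) = ∣1⇒≡1 d∣1
coprime-prodFin (suc r) f c⊥f = coprime-*ʳ (c⊥f fzero) (coprime-prodFin r (f ∘ fsuc) (c⊥f ∘ fsuc))

prodFin-punchIn : ∀ r (f : Fin (suc r) → ℕ) a →
                  prodFin (suc r) f ≡ f a * prodFin r (f ∘ punchIn a)
prodFin-punchIn r       f fzero    = refl
prodFin-punchIn (suc r) f (fsuc a) =
  trans (cong (f fzero *_) (prodFin-punchIn r (f ∘ fsuc) a)) (x∙yz≈y∙xz (f fzero) (f (fsuc a)) _)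

∣prodFin-punchIn : ∀ r (f : Fin (suc r) → ℕ) {a i} → i ≢ a → f i ∣ prodFin r (f ∘ punchIn a)
∣prodFin-punchIn r f {a} {i} i≢a =
  subst (λ j → f j ∣ _) (Fin.punchIn-punchOut (i≢a ∘ sym))
    (∣prodFin r (f ∘ punchIn a) (punchOut (i≢a ∘ sym)))

strictMono-≢ : ∀ {r} {p : Fin r → ℕ} → (∀ i j → i <ᶠ j → p i < p j) → ∀ {i j} → i ≢ j → p i ≢ p j
strictMono-≢ p-mono {i} {j} i≢j pi≡pj with Fin.<-cmp i j
... | tri< i<j _   _   = <⇒≢ (p-mono i j i<j) pi≡pj
... | tri≈ _   i≡j _   = i≢j i≡j
... | tri> _   _   j<i = <⇒≢ (p-mono j i j<i) (sym pi≡pj)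

-- R is the p a-free part of n; the index b ≢ a exists because r ≥ 2.
module PowerGraphCut
  {n r : ℕ} (p : Fin r → ℕ) (a b : Fin r) (E R s : ℕ)
  (p-prime : ∀ i → Prime (p i))
  (p≢pa : ∀ {i} → i ≢ a → p i ≢ p a)
  (b≢a : b ≢ a)
  (p∣R : ∀ {i} → i ≢ a → p i ∣ R)
  (R-coprime : ∀ {c} → (∀ {i} → i ≢ a → ¬ p i ∣ c) → Coprime c R)
  .{{R≢0 : NonZero R}}
  (1≤s : 1 ≤ s) (s≤E : s ≤ E) (n≡P^E*R : n ≡ p a ^ E * R)
  where

  P m : ℕ
  P = p a
  m = P ^ (E ∸ s) * R

  Z : Fin n → Set
  Z = InZ n r p a s

  instance
    P≢0 : NonZero P
    P≢0 = prime⇒nonZero (p-prime a)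
    n≢0 : NonZero n
    n≢0 = subst NonZero (sym n≡P^E*R) (m*n≢0 (P ^ E) R {{m^n≢0 P E}})

  nonZero-factor : ∀ {d k} → d * k ≡ n → NonZero d
  nonZero-factor {d} d*k≡n = m*n≢0⇒m≢0 d {{subst NonZero (sym d*k≡n) n≢0}}

  m*P^s≡n : m * P ^ s ≡ n
  m*P^s≡n = begin
    P ^ (E ∸ s) * R * P ^ s  ≡⟨ xy∙z≈xz∙y (P ^ (E ∸ s)) R (P ^ s) ⟩
    P ^ (E ∸ s) * P ^ s * R  ≡⟨ cong (_* R) (sym (^-distribˡ-+-* P (E ∸ s) s)) ⟩
    P ^ (E ∸ s + s) * R      ≡⟨ cong (λ e → P ^ e * R) (m∸n+n≡m s≤E) ⟩
    P ^ E * R                ≡⟨ sym n≡P^E*R ⟩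
    n                        ∎
    where open ≡-Reasoning

  instance
    m≢0 : NonZero m
    m≢0 = nonZero-factor m*P^s≡n

  m∣n : m ∣ n
  m∣n = divides (P ^ s) (sym (trans (*-comm (P ^ s) m) m*P^s≡n))

  p∣m : ∀ {i} → i ≢ a → p i ∣ m
  p∣m i≢a = ∣n⇒∣m*n (P ^ (E ∸ s)) (p∣R i≢a)

  m/p : ∀ {i} → i ≢ a → ℕ
  m/p i≢a = quotient (p∣m i≢a)

  m/p*[p*P^s]≡n : ∀ {i} (i≢a : i ≢ a) → m/p i≢a * (p i * P ^ s) ≡ n
  m/p*[p*P^s]≡n i≢a =
    trans (sym (*-assoc (m/p i≢a) _ _))
      (trans (cong (_* P ^ s) (sym (m∣n⇒n≡quotient*m (p∣m i≢a)))) m*P^s≡n)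

  P^s∤p : ∀ {i} → i ≢ a → ¬ P ^ s ∣ p i
  P^s∤p i≢a = prime^∤prime s (p-prime a) (p-prime _) (p≢pa i≢a ∘ sym) 1≤s

  ∈Q⇒p*P^s∣ : ∀ {x} → InQ n r p a s x → ∃ λ i → i ≢ a × p i * P ^ s ∣ toℕ x
  ∈Q⇒p*P^s∣ {x} (i , i≢a , d , d*[p*P^s]≡n , n∣dx) =
    i , i≢a ,
    *-cancelˡ-∣ d {{nonZero-factor d*[p*P^s]≡n}} (subst (_∣ d * toℕ x) (sym d*[p*P^s]≡n) n∣dx)

  1<P^s : 1 < P ^ s
  1<P^s = ^-monoʳ-< P (prime>1 (p-prime a)) 1≤s

  m<n : m < n
  m<n = subst₂ _<_ (*-identityʳ m) m*P^s≡n (*-monoʳ-< m 1<P^s)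

  P^s<n : P ^ s < n
  P^s<n = subst₂ _<_ (*-identityʳ (P ^ s)) (trans (*-comm (P ^ s) m) m*P^s≡n)
    (*-monoʳ-< (P ^ s) {{m^n≢0 P s}} (<-≤-trans (prime>1 (p-prime b)) (∣⇒≤ (p∣m b≢a))))

  pb<n : p b < n
  pb<n = ≤-<-trans (∣⇒≤ (p∣m b≢a)) m<n

  u v : Fin n
  u = fromℕ< P^s<n
  v = fromℕ< pb<n

  pb∣n : p b ∣ n
  pb∣n = ∣-trans (p∣m b≢a) m∣n

  n/pb : ℕ
  n/pb = quotient pb∣n

  u-order : IsOrder n u m
  u-order = divisor-isOrder u (trans (cong (m *_) (Fin.toℕ-fromℕ< P^s<n)) m*P^s≡n)

  v-order : IsOrder n v n/pb
  v-order = divisor-isOrder v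
    (trans (cong (n/pb *_) (Fin.toℕ-fromℕ< pb<n)) (sym (m∣n⇒n≡quotient*m pb∣n)))

  u∈S : InS n m u
  u∈S = let (_ , n∣mu , _) = u-order in n∣mu

  v∉S : ¬ InS n m v
  v∉S n∣mv = P^s∤p b≢a
    (*-cancelˡ-∣ m (subst₂ _∣_ (sym m*P^s≡n) (cong (m *_) (Fin.toℕ-fromℕ< pb<n)) n∣mv))

  u∉Z : ¬ Z u
  u∉Z (inj₁ (j , j<s , d , d*P^j≡n , u-order′)) =
    <⇒≢ (^-monoʳ-< P (prime>1 (p-prime a)) j<s) (*-cancelˡ-≡ _ _ m (begin
      m * P ^ j  ≡⟨ cong (_* P ^ j) (isOrder-unique u-order u-order′) ⟩
      d * P ^ j  ≡⟨ d*P^j≡n ⟩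
      n          ≡⟨ sym m*P^s≡n ⟩
      m * P ^ s  ∎))
    where open ≡-Reasoning
  u∉Z (inj₂ u∈Q) with ∈Q⇒p*P^s∣ u∈Q
  ... | i , _ , p*P^s∣u = prime≢1 (p-prime i) (∣1⇒≡1 (*-cancelʳ-∣ (P ^ s) {{m^n≢0 P s}}
    (subst (_ ∣_) (trans (Fin.toℕ-fromℕ< P^s<n) (sym (*-identityˡ (P ^ s)))) p*P^s∣u)))

  v∉Z : ¬ Z v
  v∉Z (inj₁ (j , _ , d , d*P^j≡n , v-order′)) =
    prime^≢prime j (p-prime a) (p-prime b) (p≢pa b≢a ∘ sym)
      (*-cancelˡ-≡ _ _ n/pb {{nonZero-factor n/pb*P^j≡n}} (begin
      n/pb * P ^ j  ≡⟨ n/pb*P^j≡n ⟩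
      n             ≡⟨ m∣n⇒n≡quotient*m pb∣n ⟩
      n/pb * p b    ∎))
    where
    open ≡-Reasoning
    n/pb*P^j≡n : n/pb * P ^ j ≡ n
    n/pb*P^j≡n = trans (cong (_* P ^ j) (isOrder-unique v-order v-order′)) d*P^j≡n
  v∉Z (inj₂ v∈Q) with ∈Q⇒p*P^s∣ v∈Q
  ... | i , _ , p*P^s∣v =
    P^s∤p b≢a (m*n∣⇒n∣ (p i) (P ^ s) (subst (_ ∣_) (Fin.toℕ-fromℕ< pb<n) p*P^s∣v))

  p∤gcd : ∀ {d w k i} → d * gcd w n ≡ n → n ∣ m * (k * w) →
          (i≢a : i ≢ a) → ¬ n ∣ m/p i≢a * (k * w) → ¬ p i ∣ gcd w n
  p∤gcd {d} {w} {k} {i} d*g≡n n∣mkw i≢a n∤m′kw (divides g′ g≡g′p) = n∤m′kw n∣m′kw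
    where
    open ≡-Reasoning
    instance _ = prime⇒nonZero (p-prime i)
    m′ = m/p i≢a
    m≡m′p : m ≡ m′ * p i
    m≡m′p = m∣n⇒n≡quotient*m (p∣m i≢a)
    order : ∀ {t} → n ∣ t * w ⇔ d ∣ t
    order = ∣*⇔cofactor∣ d*g≡n
    d*g′≡m′*P^s : d * g′ ≡ m′ * P ^ s
    d*g′≡m′*P^s = *-cancelʳ-≡ _ _ (p i) (begin
      d * g′ * p i      ≡⟨ *-assoc d g′ (p i) ⟩
      d * (g′ * p i)    ≡⟨ cong (d *_) (sym g≡g′p) ⟩
      d * gcd w n       ≡⟨ d*g≡n ⟩
      n                 ≡⟨ sym m*P^s≡n ⟩
      m * P ^ s         ≡⟨ cong (_* P ^ s) m≡m′p ⟩
      m′ * p i * P ^ s  ≡⟨ xy∙z≈xz∙y m′ (p i) (P ^ s) ⟩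
      m′ * P ^ s * p i  ∎)
    d∣p*m′k : d ∣ p i * (m′ * k)
    d∣p*m′k = subst (d ∣_) (trans (cong (_* k) m≡m′p) (xy∙z≈y∙xz m′ (p i) k))
      (order .to (subst (n ∣_) (sym (*-assoc m k w)) n∣mkw))
    d∣P^s*m′k : d ∣ P ^ s * (m′ * k)
    d∣P^s*m′k = subst (d ∣_) (trans (cong (_* k) d*g′≡m′*P^s) (xy∙z≈y∙xz m′ (P ^ s) k))
      (∣m⇒∣m*n k (m∣m*n g′))
    p⊥P^s : Coprime (p i) (P ^ s)
    p⊥P^s = coprime-^ʳ s
      (∤prime⇒coprime (p-prime a) (prime∤prime (p-prime a) (p-prime i) (p≢pa i≢a ∘ sym)))
    n∣m′kw : n ∣ m′ * (k * w)
    n∣m′kw = subst (n ∣_) (*-assoc m′ k w)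
      (order .from (coprime-factors p⊥P^s (d∣p*m′k , d∣P^s*m′k)))

  gcd≡P^ : ∀ {w} → (∀ {i} → i ≢ a → ¬ p i ∣ gcd w n) → ∃ λ j → gcd w n ≡ P ^ j
  gcd≡P^ {w} p∤g = ∣prime^⇒≡prime^ E (p-prime a) (coprime-divisor (R-coprime p∤g)
    (subst (gcd w n ∣_) (trans n≡P^E*R (*-comm (P ^ E) R)) (gcd[m,n]∣n w n)))

  gcd≡P^⇒<s : ∀ {d w j} → d * gcd w n ≡ n → gcd w n ≡ P ^ j → ¬ n ∣ m * w → j < s
  gcd≡P^⇒<s {d} {w} {j} d*g≡n g≡P^j n∤mw =
    ≰⇒> λ s≤j → n∤mw (∣*⇔cofactor∣ d*g≡n .from (divides (P ^ (j ∸ s)) (m≡P^[j-s]*d s≤j)))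
    where
    open ≡-Reasoning
    m≡P^[j-s]*d : s ≤ j → m ≡ P ^ (j ∸ s) * d
    m≡P^[j-s]*d s≤j = *-cancelʳ-≡ _ _ (P ^ s) {{m^n≢0 P s}} (begin
      m * P ^ s                ≡⟨ m*P^s≡n ⟩
      n                        ≡⟨ sym d*g≡n ⟩
      d * gcd w n              ≡⟨ cong (d *_) g≡P^j ⟩
      d * P ^ j                ≡⟨ cong (λ e → d * P ^ e) (sym (m∸n+n≡m s≤j)) ⟩
      d * P ^ (j ∸ s + s)      ≡⟨ cong (d *_) (^-distribˡ-+-* P (j ∸ s) s) ⟩
      d * (P ^ (j ∸ s) * P ^ s) ≡⟨ x∙yz≈yx∙z d (P ^ (j ∸ s)) (P ^ s) ⟩
      P ^ (j ∸ s) * d * P ^ s  ∎)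

  power-source∈Z : ∀ {x y k q} → k * toℕ y ≡ toℕ x + q * n →
                   InS n m x → ¬ InQ n r p a s x → ¬ InS n m y → Z y
  power-source∈Z {x} {y} {k} {q} ky≡x x∈S x∉Q y∉S =
    let j , g≡P^j = gcd≡P^ {toℕ y} p∤g in
    inj₁ (j , gcd≡P^⇒<s {d} d*g≡n g≡P^j y∉S , d ,
          trans (cong (d *_) (sym g≡P^j)) d*g≡n , cofactor-isOrder {d = d} y d*g≡n)
    where
    g∣n = gcd[m,n]∣n (toℕ y) n
    d = quotient g∣n
    d*g≡n : d * gcd (toℕ y) n ≡ n
    d*g≡n = sym (m∣n⇒n≡quotient*m g∣n)
    p∤g : ∀ {i} → i ≢ a → ¬ p i ∣ gcd (toℕ y) n
    p∤g i≢a = p∤gcd {d} {k = k} d*g≡n (∣*⇔∣*-mod {q = q} {c = m} ky≡x .from x∈S) i≢a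
      λ n∣m′ky → x∉Q (_ , i≢a , m/p i≢a , m/p*[p*P^s]≡n i≢a ,
                      ∣*⇔∣*-mod {q = q} {c = m/p i≢a} ky≡x .to n∣m′ky)

  S-closed : ∀ {x y} → InS n m x → ¬ Z x → ¬ Z y → Adj n x y → InS n m y
  S-closed {x} x∈S _ _ (_ , inj₁ (k , q , kx≡y)) =
    ∣*⇔∣*-mod {q = q} {c = m} kx≡y .to
      (subst (n ∣_) (x∙yz≈y∙xz k m (toℕ x)) (∣n⇒∣m*n k x∈S))
  S-closed {y = y} x∈S x∉Z y∉Z (_ , inj₂ (k , q , ky≡x)) with n ∣? m * toℕ y
  ... | yes y∈S = y∈S
  ... | no  y∉S = contradiction (power-source∈Z {k = k} {q} ky≡x x∈S (x∉Z ∘ inj₂) y∉S) y∉Z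

  isCutSet : IsCutSet n Z
  isCutSet = closed⇒isCutSet u v u∉Z v∉Z u∈S v∉S S-closed

proposition3p1 : (n r : ℕ) (p e : Fin r → ℕ) →
    2 ≤ r →
    (∀ i → Prime (p i)) →
    (∀ i j → i <ᶠ j → p i < p j) →
    (∀ i → 1 ≤ e i) →
    n ≡ prodFin r (λ i → p i ^ e i) →
    (a : Fin r) (s : ℕ) → 1 ≤ s → s ≤ e a →
    IsCutSet n (InZ n r p a s)
proposition3p1 n (suc (suc r)) p e (s≤s (s≤s z≤n)) p-prime p-mono 1≤e n≡∏ a s 1≤s s≤e =
  PowerGraphCut.isCutSet p a (punchIn a fzero) (e a) R s p-prime (strictMono-≢ p-mono)
    (Fin.punchInᵢ≢i a fzero) p∣R R-coprime 1≤s s≤e (trans n≡∏ (prodFin-punchIn _ p^e a))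
  where
  p^e : Fin (suc (suc r)) → ℕ
  p^e i = p i ^ e i
  R : ℕ
  R = prodFin (suc r) (p^e ∘ punchIn a)
  instance
    R≢0 : NonZero R
    R≢0 = prodFin-nonZero (suc r) (p^e ∘ punchIn a) λ i →
      m^n≢0 (p (punchIn a i)) (e (punchIn a i)) {{prime⇒nonZero (p-prime (punchIn a i))}}
  p∣R : ∀ {i} → i ≢ a → p i ∣ R
  p∣R {i} i≢a = ∣-trans (m∣m^n (e i) (1≤e i)) (∣prodFin-punchIn _ p^e i≢a)
  R-coprime : ∀ {c} → (∀ {i} → i ≢ a → ¬ p i ∣ c) → Coprime c R
  R-coprime p∤c = coprime-prodFin (suc r) (p^e ∘ punchIn a) λ i →
    coprime-^ʳ (e (punchIn a i))
      (∤prime⇒coprime (p-prime (punchIn a i)) (p∤c (Fin.punchInᵢ≢i a i)))
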